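{- The two equivalence relations $\sim_{N^\infty}$ and $\sim_T$ on $\mathcal{Q}_N(d_K)$ are the same.
   Context: Let $K$ be an imaginary quadratic field of discriminant $d_K$, $K\neq\mathbb{Q}(\sqrt{ -1}),\mathbb{Q}(\sqrt{ -3})$, and $N\geq2$ an integer. $\mathcal{Q}_N(d_K)$ is the set of primitive positive definite forms $ax^2+bxy+cy^2\in\mathbb{Z}[x,y]$ of discriminant $d_K$ with $\gcd(N,a)=1$. For $M\ge1$, $Q\sim_M Q'$ iff $Q'\left(\begin{bmatrix}x\\ y\end{bmatrix}\right)=Q\left(\sigma\begin{bmatrix}x\\ y\end{bmatrix}\right)$ for some $\sigma\in\pm\Gamma_1(M)=\{\sigma\in\mathrm{SL}_2(\mathbb{Z}):\sigma\equiv\pm\begin{bmatrix}1&*\\ 0&1\end{bmatrix}\pmod M\}$. $Q\sim_{N^\infty}Q'$ iff $Q\sim_{N^\ell}Q'$ for all $\ell\ge1$. With $T=\begin{bmatrix}1&1\\ 0&1\end{bmatrix}$, $Q\sim_T Q'$ iff $Q'\left(\begin{bmatrix}x\\ y\end{bmatrix}\right)=Q\left(\sigma\begin{bmatrix}x\\ y\end{bmatrix}\right)$ for some $\sigma\in\langle -I_2,T\rangle$. -}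

module Defs where

open import Data.Nat as ℕ using (ℕ; suc)
open import Data.Integer as ℤ using (ℤ; +_; -_; _+_; _-_; _*_; _<_; ∣_∣)
open import Data.Integer.Divisibility using (_∣_)
open import Data.Integer.GCD using (gcd)
open import Data.Nat.Coprimality using (Coprime)
open import Data.Product using (Σ; _×_; _,_; ∃)
open import Data.Sum using (_⊎_)
open import Relation.Binary.PropositionalEquality using (_≡_; _≢_)

Squarefree : ℤ → Set
Squarefree m = ∀ (k : ℕ) → (+ (k ℕ.* k)) ∣ m → k ≡ 1

-- d is a fundamental discriminant (d ≠ 1 is automatic for d < 0):
-- d ≡ 1 (mod 4) and d squarefree, or d = 4m with m ≡ 2,3 (mod 4) and m squarefree
FundamentalDisc : ℤ → Set
FundamentalDisc d =
  (((+ 4) ∣ (d - + 1)) × Squarefree d)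
  ⊎ (Σ ℤ λ m → d ≡ + 4 * m × (((+ 4) ∣ (m - + 2)) ⊎ ((+ 4) ∣ (m - + 3))) × Squarefree m)

-- d is the discriminant d_K of an imaginary quadratic field K ≠ ℚ(√-1), ℚ(√-3)
ImagQuadDisc : ℤ → Set
ImagQuadDisc d = FundamentalDisc d × d < + 0 × d ≢ - (+ 4) × d ≢ - (+ 3)

-- binary quadratic form a x² + b x y + c y², as coefficient triple (a , b , c)
record Form : Set where
  constructor form
  field
    a b c : ℤ
open Form public

disc : Form → ℤ
disc Q = b Q * b Q - + 4 * a Q * c Q

InQN : ℕ → ℤ → Form → Set
InQN N d Q =
  gcd (gcd (a Q) (b Q)) (c Q) ≡ + 1
  × + 0 < a Q
  × disc Q ≡ d
  × Coprime N (∣ a Q ∣)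

-- integer 2×2 matrix [[p , q] , [r , s]]
record Mat : Set where
  constructor mat
  field
    p q r s : ℤ
open Mat public

det : Mat → ℤ
det σ = p σ * s σ - q σ * r σ

-- the form (x , y) ↦ Q(σ (x , y)) = Q(p x + q y , r x + s y)
act : Form → Mat → Form
act (form a b c) (mat p q r s) =
  form (a * p * p + b * p * r + c * r * r)
       (+ 2 * a * p * q + b * (p * s + q * r) + + 2 * c * r * s)
       (a * q * q + b * q * s + c * s * s)

InPmΓ₁ : ℕ → Mat → Set
InPmΓ₁ M σ =
  det σ ≡ + 1 ×
  Σ ℤ λ ε → (ε ≡ + 1 ⊎ ε ≡ - (+ 1)) ×
    (((+ M) ∣ (p σ - ε)) × ((+ M) ∣ r σ) × ((+ M) ∣ (s σ - ε)))

-- σ ∈ ⟨-I₂, T⟩ = { ε Tᵏ : ε = ±1, k ∈ ℤ }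
InTgrp : Mat → Set
InTgrp σ = Σ ℤ λ ε → Σ ℤ λ k → (ε ≡ + 1 ⊎ ε ≡ - (+ 1)) × σ ≡ mat ε (ε * k) (+ 0) ε

_∼[_]_ : Form → ℕ → Form → Set
Q ∼[ M ] Q' = Σ Mat λ σ → InPmΓ₁ M σ × Q' ≡ act Q σ

_∼∞[_]_ : Form → ℕ → Form → Set
Q ∼∞[ N ] Q' = ∀ (ℓ : ℕ) → 1 ℕ.≤ ℓ → Q ∼[ N ℕ.^ ℓ ] Q'

_∼T_ : Form → Form → Set
Q ∼T Q' = Σ Mat λ σ → InTgrp σ × Q' ≡ act Q σ

-- If Q' = Q ∘ σ then, writing σ = [[p , q] , [r , s]] and d = disc Q,
-- 4 a(Q) a(Q') = (2 a p + b r)² − d r², so for d < 0 we get |r| ≤ |4 a(Q) a(Q')|.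
-- When σ ∈ ±Γ₁(N^ℓ) with N^ℓ above that bound, N^ℓ ∣ r forces r = 0, and a
-- determinant-one upper triangular integer matrix is ±Tᵏ.  Conversely ±Tᵏ lies in
-- every ±Γ₁(M).
module Submission where

open import Defs
open import Data.Nat as ℕ using (ℕ; zero; suc; _≤_; z≤n; s≤s)
open import Data.Nat.Properties as ℕ
  using (≤-trans; <-trans; n<1+n; m≤m*n; m≤n*m; m≤n+m; m*n≡1⇒m≡1; m*n≡1⇒n≡1; ^-monoʳ-<; module ≤-Reasoning)
open import Data.Nat.Divisibility as ℕ using (>⇒∤; _∣0)
open import Data.Integer as ℤ using (ℤ; +_; +[1+_]; -[1+_]; -_; _+_; _-_; _*_; ∣_∣)
open import Data.Integer.Properties as ℤ
  using (abs-*; pos-*; pos-+; ∣i∣≡0⇒i≡0; neg-mono-<; +-inverseʳ; *-assoc; *-identityˡ; *-zeroʳ; +-identityʳ)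
open import Data.Integer.Divisibility using (_∣_)
open import Data.Integer.Tactic.RingSolver using (solve-∀)
open import Data.Product using (_×_; _,_)
open import Data.Sum using (_⊎_; inj₁; inj₂)
open import Relation.Nullary using (contradiction)
open import Relation.Binary.PropositionalEquality
  using (_≡_; refl; sym; trans; cong; subst; module ≡-Reasoning)

n<m^n : ∀ {m} → 1 ℕ.< m → ∀ n → n ℕ.< m ℕ.^ n
n<m^n 1<m zero = s≤s z≤n
n<m^n {m} 1<m (suc n) = ≤-trans (s≤s (n<m^n 1<m n)) (^-monoʳ-< m 1<m (n<1+n n))

m∣n∧n<m⇒n≡0 : ∀ {m n} → m ℕ.∣ n → n ℕ.< m → n ≡ 0
m∣n∧n<m⇒n≡0 {n = zero} _ _ = refl
m∣n∧n<m⇒n≡0 {n = suc _} m∣n n<m = contradiction m∣n (>⇒∤ n<m)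

k∣i∧∣i∣<k⇒i≡0 : ∀ {k i} → + k ∣ i → ∣ i ∣ ℕ.< k → i ≡ + 0
k∣i∧∣i∣<k⇒i≡0 k∣i ∣i∣<k = ∣i∣≡0⇒i≡0 (m∣n∧n<m⇒n≡0 k∣i ∣i∣<k)

n≤n*n : ∀ n → n ≤ n ℕ.* n
n≤n*n zero = z≤n
n≤n*n n@(suc _) = m≤m*n n n

i*i≡∣i∣*∣i∣ : ∀ i → i * i ≡ + (∣ i ∣ ℕ.* ∣ i ∣)
i*i≡∣i∣*∣i∣ (+ 0) = refl
i*i≡∣i∣*∣i∣ +[1+ _ ] = refl
i*i≡∣i∣*∣i∣ -[1+ _ ] = refl

∣i∣≤∣j*j+k*[i*i]∣ : ∀ i j k → + 0 ℤ.< k → ∣ i ∣ ≤ ∣ j * j + k * (i * i) ∣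
∣i∣≤∣j*j+k*[i*i]∣ i j (+ 0) (ℤ.+<+ ())
∣i∣≤∣j*j+k*[i*i]∣ i j k@(+ k′@(suc _)) _ = begin
  ∣ i ∣                     ≤⟨ n≤n*n ∣ i ∣ ⟩
  i²                        ≤⟨ m≤n*m i² k′ ⟩
  k′ ℕ.* i²                 ≤⟨ m≤n+m _ j² ⟩
  j² ℕ.+ k′ ℕ.* i²          ≡⟨ cong ∣_∣ as-ℕ ⟨
  ∣ j * j + k * (i * i) ∣   ∎
  where
  open ≤-Reasoning
  i² j² : ℕ
  i² = ∣ i ∣ ℕ.* ∣ i ∣
  j² = ∣ j ∣ ℕ.* ∣ j ∣
  as-ℕ : j * j + k * (i * i) ≡ + (j² ℕ.+ k′ ℕ.* i²)
  as-ℕ rewrite i*i≡∣i∣*∣i∣ i | i*i≡∣i∣*∣i∣ j =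
    trans (cong (_+_ (+ j²)) (sym (pos-* k′ i²))) (sym (pos-+ j² (k′ ℕ.* i²)))

four-a-value : ∀ Q σ → + 4 * a Q * a (act Q σ)
  ≡ (+ 2 * a Q * p σ + b Q * r σ) * (+ 2 * a Q * p σ + b Q * r σ) + (- disc Q) * (r σ * r σ)
four-a-value Q σ = identity (a Q) (b Q) (c Q) (p σ) (r σ)
  where
  identity : ∀ a b c p r → + 4 * a * (a * p * p + b * p * r + c * r * r)
    ≡ (+ 2 * a * p + b * r) * (+ 2 * a * p + b * r) + (- (b * b - + 4 * a * c)) * (r * r)
  identity = solve-∀

∣r∣≤∣4a·a′∣ : ∀ Q σ → disc Q ℤ.< + 0 → ∣ r σ ∣ ≤ ∣ + 4 * a Q * a (act Q σ) ∣
∣r∣≤∣4a·a′∣ Q σ d<0 =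
  subst (λ n → ∣ r σ ∣ ≤ ∣ n ∣) (sym (four-a-value Q σ))
    (∣i∣≤∣j*j+k*[i*i]∣ (r σ) (+ 2 * a Q * p σ + b Q * r σ) (- disc Q) (neg-mono-< d<0))

Sign : ℤ → Set
Sign ε = ε ≡ + 1 ⊎ ε ≡ - + 1

Sign⇒ε*ε≡1 : ∀ {ε} → Sign ε → ε * ε ≡ + 1
Sign⇒ε*ε≡1 (inj₁ refl) = refl
Sign⇒ε*ε≡1 (inj₂ refl) = refl

∣i∣≡1⇒Sign : ∀ {i} → ∣ i ∣ ≡ 1 → Sign i
∣i∣≡1⇒Sign {+ 1} _ = inj₁ refl
∣i∣≡1⇒Sign { -[1+ 0 ]} _ = inj₂ refl
∣i∣≡1⇒Sign {+ 0} ()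
∣i∣≡1⇒Sign {+ suc (suc _)} ()
∣i∣≡1⇒Sign { -[1+ suc _ ]} ()

i*j≡1⇒Sign∧i≡j : ∀ i j → i * j ≡ + 1 → Sign i × i ≡ j
i*j≡1⇒Sign∧i≡j i j ij≡1 =
  same (∣i∣≡1⇒Sign (m*n≡1⇒m≡1 ∣ i ∣ ∣ j ∣ ∣i∣∣j∣≡1)) (∣i∣≡1⇒Sign (m*n≡1⇒n≡1 ∣ i ∣ ∣ j ∣ ∣i∣∣j∣≡1)) ij≡1
  where
  ∣i∣∣j∣≡1 : ∣ i ∣ ℕ.* ∣ j ∣ ≡ 1
  ∣i∣∣j∣≡1 = trans (sym (abs-* i j)) (cong ∣_∣ ij≡1)
  same : Sign i → Sign j → i * j ≡ + 1 → Sign i × i ≡ j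
  same (inj₁ refl) (inj₁ refl) _ = inj₁ refl , refl
  same (inj₂ refl) (inj₂ refl) _ = inj₂ refl , refl
  same (inj₁ refl) (inj₂ refl) ()
  same (inj₂ refl) (inj₁ refl) ()

det-upper-triangular : ∀ p q s → det (mat p q (+ 0) s) ≡ p * s
det-upper-triangular p q s = trans (cong (λ x → p * s - x) (*-zeroʳ q)) (+-identityʳ (p * s))

r≡0∧det≡1⇒InTgrp : ∀ σ → r σ ≡ + 0 → det σ ≡ + 1 → InTgrp σ
r≡0∧det≡1⇒InTgrp (mat ε q .(+ 0) s) refl det≡1 
  with i*j≡1⇒Sign∧i≡j ε s (trans (sym (det-upper-triangular ε q s)) det≡1)
... | ±ε , refl = ε , ε * q , ±ε , cong (λ x → mat ε x (+ 0) ε) ε[εq]≡q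
  where
  open ≡-Reasoning
  ε[εq]≡q : q ≡ ε * (ε * q)
  ε[εq]≡q = begin
    q             ≡⟨ *-identityˡ q ⟨
    + 1 * q       ≡⟨ cong (_* q) (Sign⇒ε*ε≡1 ±ε) ⟨
    ε * ε * q     ≡⟨ *-assoc ε ε q ⟩
    ε * (ε * q)   ∎

InTgrp⇒InPmΓ₁ : ∀ M {σ} → InTgrp σ → InPmΓ₁ M σ
InTgrp⇒InPmΓ₁ M (ε , k , ±ε , refl) = det≡1 , ε , ±ε , M∣ε-ε , M ∣0 , M∣ε-ε
  where
  det≡1 : det (mat ε (ε * k) (+ 0) ε) ≡ + 1
  det≡1 = trans (det-upper-triangular ε (ε * k) ε) (Sign⇒ε*ε≡1 ±ε)
  M∣ε-ε : + M ∣ ε - ε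
  M∣ε-ε = subst (+ M ∣_) (sym (+-inverseʳ ε)) (M ∣0)

∼∞⇒∼T : ∀ {N Q Q′} → 1 ℕ.< N → disc Q ℤ.< + 0 → Q ∼∞[ N ] Q′ → Q ∼T Q′
∼∞⇒∼T {Q = Q} {Q′} 1<N d<0 Q∼Q′ with Q∼Q′ (suc ℓ) (s≤s z≤n)
  where ℓ = ∣ + 4 * a Q * a Q′ ∣
... | σ , (det≡1 , _ , _ , _ , Nᵏ∣r , _) , refl =
  σ , r≡0∧det≡1⇒InTgrp σ r≡0 det≡1 , refl
  where
  r≡0 : r σ ≡ + 0
  r≡0 = k∣i∧∣i∣<k⇒i≡0 Nᵏ∣r (<-trans (s≤s (∣r∣≤∣4a·a′∣ Q σ d<0)) (n<m^n 1<N _))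

∼T⇒∼∞ : ∀ {N Q Q′} → Q ∼T Q′ → Q ∼∞[ N ] Q′
∼T⇒∼∞ {N} (σ , σ∈T , Q′≡Qσ) ℓ _ = σ , InTgrp⇒InPmΓ₁ (N ℕ.^ ℓ) σ∈T , Q′≡Qσ

lemma5p2 : (d : ℤ) → ImagQuadDisc d → (N : ℕ) → 2 ≤ N →
    (Q Q' : Form) → InQN N d Q → InQN N d Q' →
    ((Q ∼∞[ N ] Q' → Q ∼T Q') × (Q ∼T Q' → Q ∼∞[ N ] Q'))
lemma5p2 _ (_ , d<0 , _) N 2≤N Q Q' (_ , _ , refl , _) _ = ∼∞⇒∼T {N} {Q} {Q'} 2≤N d<0 , ∼T⇒∼∞ {N} {Q} {Q'}
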